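{- Every level-1 network, and hence every galled-tree, has the global lca-property and is a holju graph.
   Context: A DAG is a finite directed graph without loops and directed cycles; $u\preceq_G v$ means there is a directed path from $v$ to $u$ (including $u=v$). A network is a DAG with exactly one $\preceq$-maximal vertex. For non-empty $A\subseteq V(N)$, $\mathrm{LCA}_N(A)$ is the set of $\preceq_N$-minimal vertices $v$ with $a\preceq_N v$ for all $a\in A$; $N$ has the global lca-property if $|\mathrm{LCA}_N(A)|=1$ for all non-empty $A\subseteq V(N)$. A network $N$ is level-1 if every maximal biconnected subgraph (biconnected component) contains at most one vertex $v$ with in-degree greater than one in $N$. A network is a galled-tree if each maximal biconnected subgraph is a single vertex, a single edge, or consists of exactly two directed $uv$-paths sharing only $u$ and $v$. For a DAG $G$, $W\subseteq V(G)$, $v\in V(G)$, let $\mathcal{L}_G(W\mid v)=\bigcup_{w\in W}\mathrm{LCA}_G(\{w,v\})$. Holju graphs are defined recursively: $K_1$ (one vertex, no edges) is holju; if $G$ is holju, so is any graph obtained by adding a new vertex $x\notin V(G)$ and edges $(w,x)$ for all $w\in W$, where $\emptyset\ne W\subseteq V(G)$ is such that for every $v\in V(G)$ the set $\mathcal{L}_G(W\mid v)$ has a unique $\preceq_G$-minimal vertex. -}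

module Defs where

open import Data.Nat using (ℕ; zero; suc; _<_)
open import Data.Fin using (Fin; zero; suc)
open import Data.Fin.Permutation using (Permutation′; _⟨$⟩ʳ_)
open import Data.Bool using (Bool; true; false; if_then_else_)
open import Data.List using (List; map; allFin)
open import Data.Nat.ListAction using (sum)
open import Data.Product using (Σ; Σ-syntax; _×_; _,_)
open import Data.Sum using (_⊎_)
open import Data.Empty using (⊥)
open import Relation.Nullary using (¬_)
open import Relation.Binary.PropositionalEquality using (_≡_; _≢_)
open import Relation.Binary.Construct.Closure.ReflexiveTransitive using (Star)
open import Function.Bundles using (_⇔_)

Graph : ℕ → Set
Graph n = Fin n → Fin n → Bool

module _ {n : ℕ} (E : Graph n) where

  Edge : Fin n → Fin n → Set
  Edge u v = E u v ≡ true

  _⪯_ : Fin n → Fin n → Set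
  u ⪯ v = Star Edge v u

  -- DAG: no loops and no directed cycles
  -- (an edge (u,v) together with a path from v back to u is excluded;
  --  u = v covers loops)
  IsDAG : Set
  IsDAG = ∀ u v → Edge u v → ¬ (u ⪯ v)

  IsMaximal : Fin n → Set
  IsMaximal r = ∀ w → r ⪯ w → w ≡ r

  IsNetwork : Set
  IsNetwork = IsDAG × Σ[ r ∈ Fin n ] (IsMaximal r × (∀ r' → IsMaximal r' → r' ≡ r))

  IsLCA : (Fin n → Set) → Fin n → Set
  IsLCA A v = (∀ a → A a → a ⪯ v)
            × (∀ w → (∀ a → A a → a ⪯ w) → w ⪯ v → w ≡ v)

  GlobalLCA : Set
  GlobalLCA = (A : Fin n → Bool) → Σ[ a ∈ Fin n ] (A a ≡ true) →
              Σ[ v ∈ Fin n ] (IsLCA (λ x → A x ≡ true) v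
                              × (∀ w → IsLCA (λ x → A x ≡ true) w → w ≡ v))

  indeg : Fin n → ℕ
  indeg v = sum (map (λ u → if E u v then 1 else 0) (allFin n))

  record Subgraph : Set where
    field
      vs  : Fin n → Bool
      es  : Fin n → Fin n → Bool
      es⊆ : ∀ a b → es a b ≡ true → (E a b ≡ true × vs a ≡ true × vs b ≡ true)
  open Subgraph public

  UAdj : Subgraph → Fin n → Fin n → Set
  UAdj H a b = es H a b ≡ true ⊎ es H b a ≡ true

  UAdjWithout : Subgraph → Fin n → Fin n → Fin n → Set
  UAdjWithout H x a b = UAdj H a b × a ≢ x × b ≢ x

  Connected : Subgraph → Set
  Connected H = ∀ a b → vs H a ≡ true → vs H b ≡ true → Star (UAdj H) a b

  ConnectedWithout : Subgraph → Fin n → Set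
  ConnectedWithout H x = ∀ a b → vs H a ≡ true → vs H b ≡ true → a ≢ x → b ≢ x →
                         Star (UAdjWithout H x) a b

  Biconnected : Subgraph → Set
  Biconnected H = Connected H × (∀ x → vs H x ≡ true → ConnectedWithout H x)

  _⊑_ : Subgraph → Subgraph → Set
  H ⊑ H' = (∀ a → vs H a ≡ true → vs H' a ≡ true)
         × (∀ a b → es H a b ≡ true → es H' a b ≡ true)

  MaxBiconnected : Subgraph → Set
  MaxBiconnected H = Biconnected H × (∀ H' → Biconnected H' → H ⊑ H' → H' ⊑ H)

  IsLevel1 : Set
  IsLevel1 = ∀ H → MaxBiconnected H → ∀ u v → vs H u ≡ true → vs H v ≡ true →
             1 < indeg u → 1 < indeg v → u ≡ v

  data DPath : Fin n → Fin n → Set where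
    stop : ∀ v → DPath v v
    step : ∀ {u w v} → Edge u w → DPath w v → DPath u v

  _∈P_ : ∀ {u v} → Fin n → DPath u v → Set
  y ∈P stop v = y ≡ v
  y ∈P step {u} _ p = y ≡ u ⊎ y ∈P p

  EdgeP : ∀ {u v} → DPath u v → Fin n → Fin n → Set
  EdgeP (stop _) c d = ⊥
  EdgeP (step {u} {w} _ p) c d = (c ≡ u × d ≡ w) ⊎ EdgeP p c d

  SingleVertex : Subgraph → Set
  SingleVertex H = Σ[ x ∈ Fin n ] ((∀ y → (vs H y ≡ true) ⇔ (y ≡ x))
                                  × (∀ a b → es H a b ≡ false))

  SingleEdge : Subgraph → Set
  SingleEdge H = Σ[ a ∈ Fin n ] Σ[ b ∈ Fin n ]
                   ((∀ y → (vs H y ≡ true) ⇔ (y ≡ a ⊎ y ≡ b))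
                   × (∀ c d → (es H c d ≡ true) ⇔ (c ≡ a × d ≡ b)))

  TwoPaths : Subgraph → Set
  TwoPaths H = Σ[ u ∈ Fin n ] Σ[ v ∈ Fin n ] Σ[ p ∈ DPath u v ] Σ[ q ∈ DPath u v ]
                 (u ≢ v × ¬ (p ≡ q)
                 × (∀ y → (vs H y ≡ true) ⇔ (y ∈P p ⊎ y ∈P q))
                 × (∀ c d → (es H c d ≡ true) ⇔ (EdgeP p c d ⊎ EdgeP q c d))
                 × (∀ y → y ∈P p → y ∈P q → y ≡ u ⊎ y ≡ v))

  IsGalledTree : Set
  IsGalledTree = IsNetwork × (∀ H → MaxBiconnected H →
                   SingleVertex H ⊎ SingleEdge H ⊎ TwoPaths H)

  -- y ∈ 𝓛_G(W | v) = ⋃_{w ∈ W} LCA_G({w, v})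
  InL : (Fin n → Bool) → Fin n → Fin n → Set
  InL W v y = Σ[ w ∈ Fin n ] (W w ≡ true × IsLCA (λ a → a ≡ w ⊎ a ≡ v) y)

  IsMinimalIn : (Fin n → Set) → Fin n → Set
  IsMinimalIn P m = P m × (∀ y → P y → y ⪯ m → y ≡ m)

  HasUniqueMin : (Fin n → Set) → Set
  HasUniqueMin P = Σ[ m ∈ Fin n ] (IsMinimalIn P m × (∀ m' → IsMinimalIn P m' → m' ≡ m))

-- G extended by a new vertex (here: zero; old vertex i becomes suc i)
-- with edges (w , new) for w ∈ W
extend : ∀ {n} → Graph n → (Fin n → Bool) → Graph (suc n)
extend E W zero    _       = false
extend E W (suc a) zero    = W a
extend E W (suc a) (suc b) = E a b

data HoljuStd : (n : ℕ) → Graph n → Set where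
  k1  : ∀ {E : Graph 1} → (∀ a b → E a b ≡ false) → HoljuStd 1 E
  add : ∀ {n} {E : Graph n} {W : Fin n → Bool} {E' : Graph (suc n)} →
        HoljuStd n E →
        Σ[ w ∈ Fin n ] (W w ≡ true) →
        (∀ v → HasUniqueMin E (InL E W v)) →
        (∀ a b → E' a b ≡ extend E W a b) →
        HoljuStd (suc n) E'

-- a graph is holju if it is (isomorphic, via a relabelling of vertices, to)
-- a graph produced by the recursive construction
IsHolju : ∀ {n} → Graph n → Set
IsHolju {n} E = Σ[ π ∈ Permutation′ n ] HoljuStd n (λ a b → E (π ⟨$⟩ʳ a) (π ⟨$⟩ʳ b))

{-# OPTIONS --safe #-}

-- In a level-1 network, and in a galled tree, a biconnected subgraph contains at most one
-- vertex with two in-neighbours inside it. This forces any two vertices a, b to have a unique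
-- minimal common ancestor: given two, m₁ ≠ m₂, descend from m₁ towards a and towards b until
-- the down-set of m₂ is first entered, at h₁ and h₂; with paths from m₂ down to h₁ and h₂ this
-- closes a cycle in which h₁ ≠ h₂ both have two in-neighbours. So reachability has binary
-- joins, and folding them gives every nonempty vertex set a least upper bound: the global
-- lca-property. Deleting a sink x preserves all of this, and the in-neighbours W of x satisfy
-- the holju condition since, for every v, the join of x and v is the least element of
-- 𝓛(W | v); induction on the number of vertices rebuilds the network by holju steps.

module Submission where

open import Defs
open import Data.Nat using (ℕ; zero; suc; _+_; _*_; _≤_; _<_; _∸_; _<?_; z≤n; s≤s)
open import Data.Nat.Properties using (+-mono-≤; +-mono-<-≤; +-mono-≤-<; m≤n+m; *-identityʳ; ∸-monoʳ-<)
import Data.Nat.Properties as ℕ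
open import Data.Nat.Induction using (<-wellFounded)
open import Data.Nat.ListAction using (sum)
open import Data.Fin using (Fin; zero; suc)
open import Data.Fin.Properties using (_≟_; any?; suc-injective; ¬Fin0)
open import Data.Fin.Induction using (po-wellFounded)
open import Data.Fin.Permutation using (Permutation′; _⟨$⟩ʳ_; _⟨$⟩ˡ_; inverseʳ; transpose; lift₀; _∘ₚ_; id)
open import Data.Bool using (Bool; true; false; _∨_; _∧_; if_then_else_)
import Data.Bool as Bool
open import Data.Bool.Properties using (¬-not)
open import Data.List using (tabulate)
open import Data.List.Properties using (map-tabulate)
open import Data.Product using (Σ-syntax; _×_; _,_; proj₁; proj₂)
open import Data.Sum using (_⊎_; inj₁; inj₂; [_,_]′)
import Data.Sum as Sum
open import Data.Empty using (⊥; ⊥-elim)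
open import Data.Unit using (tt)
open import Function using (_∘_; flip)
open import Function.Bundles using (Injection; Equivalence)
open import Function.Properties.Inverse using (↔⇒↣)
open import Level using (Level; 0ℓ)
open import Induction.WellFounded using (Acc; acc)
open import Relation.Nullary using (¬_; Dec; yes; no; does; ¬?; _×-dec_)
open import Relation.Nullary.Decidable using (map′; dec-true; decidable-stable; ¬¬-excluded-middle)
open import Relation.Unary using (Pred) renaming (Decidable to Decidable₁)
open import Relation.Binary using (Rel; Decidable; IsPartialOrder)
import Relation.Binary.Construct.NonStrictToStrict as Strict
import Relation.Binary.Construct.Flip.EqAndOrd as Flip
open import Relation.Binary.PropositionalEquality using (_≡_; _≢_; refl; sym; trans; cong; subst; isEquivalence)
open import Relation.Binary.Construct.Closure.ReflexiveTransitive using (Star; ε; _◅_; _◅◅_; gmap; reverse)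

private
  variable
    a ℓ : Level
    n : ℕ

true⇒¬false : ∀ {b} → b ≡ true → b ≢ false
true⇒¬false refl ()

∨-introˡ : ∀ {x y} → x ≡ true → x ∨ y ≡ true
∨-introˡ refl = refl

∨-introʳ : ∀ {x y} → y ≡ true → x ∨ y ≡ true
∨-introʳ {true}  _    = refl
∨-introʳ {false} refl = refl

∨-elim : ∀ {x y} → x ∨ y ≡ true → x ≡ true ⊎ y ≡ true
∨-elim {true}  _   = inj₁ refl
∨-elim {false} y≡t = inj₂ y≡t

∧-intro : ∀ {x y} → x ≡ true → y ≡ true → x ∧ y ≡ true
∧-intro refl refl = refl

∧-elim : ∀ {x y} → x ∧ y ≡ true → x ≡ true × y ≡ true
∧-elim {true} {true} _ = refl , refl

_==_ : Fin n → Fin n → Bool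
x == y = does (x ≟ y)

==-refl : (x : Fin n) → x == x ≡ true
==-refl x = dec-true (x ≟ x) refl

==⇒≡ : ∀ {x y : Fin n} → x == y ≡ true → x ≡ y
==⇒≡ {x = x} {y} x==y with x ≟ y
... | yes x≡y = x≡y

-- Counting

sum-tabulate-mono-≤ : (f g : Fin n → ℕ) → (∀ i → f i ≤ g i) → sum (tabulate f) ≤ sum (tabulate g)
sum-tabulate-mono-≤ {zero}  f g f≤g = z≤n
sum-tabulate-mono-≤ {suc n} f g f≤g =
  +-mono-≤ (f≤g zero) (sum-tabulate-mono-≤ (f ∘ suc) (g ∘ suc) (f≤g ∘ suc))

sum-tabulate-mono-< : (f g : Fin n → ℕ) → (∀ i → f i ≤ g i) → ∀ i → f i < g i →
                      sum (tabulate f) < sum (tabulate g)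
sum-tabulate-mono-< f g f≤g zero    fi<gi =
  +-mono-<-≤ fi<gi (sum-tabulate-mono-≤ (f ∘ suc) (g ∘ suc) (f≤g ∘ suc))
sum-tabulate-mono-< f g f≤g (suc i) fi<gi =
  +-mono-≤-< (f≤g zero) (sum-tabulate-mono-< (f ∘ suc) (g ∘ suc) (f≤g ∘ suc) i fi<gi)

sum-tabulate-≤ : ∀ c (f : Fin n → ℕ) → (∀ i → f i ≤ c) → sum (tabulate f) ≤ n * c
sum-tabulate-≤ {zero}  c f f≤c = z≤n
sum-tabulate-≤ {suc n} c f f≤c = +-mono-≤ (f≤c zero) (sum-tabulate-≤ c (f ∘ suc) (f≤c ∘ suc))

indicator : Bool → ℕ
indicator b = if b then 1 else 0

count : (Fin n → Bool) → ℕ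
count f = sum (tabulate (indicator ∘ f))

_⊆ᵇ_ : (f g : Fin n → Bool) → Set
f ⊆ᵇ g = ∀ i → f i ≡ true → g i ≡ true

private
  indicator-mono : ∀ {x y} → (x ≡ true → y ≡ true) → indicator x ≤ indicator y
  indicator-mono {false} x⇒y = z≤n
  indicator-mono {true}  x⇒y rewrite x⇒y refl = s≤s z≤n

  indicator-≤1 : ∀ x → indicator x ≤ 1
  indicator-≤1 true  = s≤s z≤n
  indicator-≤1 false = z≤n

  indicator-< : ∀ {x y} → x ≡ false → y ≡ true → indicator x < indicator y
  indicator-< refl refl = s≤s z≤n

count-≤ : (f : Fin n → Bool) → count f ≤ n
count-≤ {n} f = subst (count f ≤_) (*-identityʳ n) (sum-tabulate-≤ 1 _ (indicator-≤1 ∘ f))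

count-mono-≤ : (f g : Fin n → Bool) → f ⊆ᵇ g → count f ≤ count g
count-mono-≤ f g f⊆g = sum-tabulate-mono-≤ _ _ (λ i → indicator-mono (f⊆g i))

count-mono-< : (f g : Fin n → Bool) → f ⊆ᵇ g → ∀ i → f i ≡ false → g i ≡ true → count f < count g
count-mono-< f g f⊆g i fi gi = sum-tabulate-mono-< _ _ (λ j → indicator-mono (f⊆g j)) i (indicator-< fi gi)

count-≥1 : (f : Fin n → Bool) (i : Fin n) → f i ≡ true → 1 ≤ count f
count-≥1 f zero    fi rewrite fi = s≤s z≤n
count-≥1 f (suc i) fi = ℕ.≤-trans (count-≥1 (f ∘ suc) i fi) (m≤n+m _ _)

count-≥2 : (f : Fin n → Bool) (i j : Fin n) → f i ≡ true → f j ≡ true → i ≢ j → 2 ≤ count f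
count-≥2 f zero    zero    fi fj i≢j = ⊥-elim (i≢j refl)
count-≥2 f zero    (suc j) fi fj i≢j rewrite fi = s≤s (count-≥1 (f ∘ suc) j fj)
count-≥2 f (suc i) zero    fi fj i≢j rewrite fj = s≤s (count-≥1 (f ∘ suc) i fi)
count-≥2 f (suc i) (suc j) fi fj i≢j =
  ℕ.≤-trans (count-≥2 (f ∘ suc) i j fi fj (i≢j ∘ cong suc)) (m≤n+m _ _)

-- Extremal elements

minimal-below : ∀ {p} {_≤_ : Rel (Fin n) ℓ} {P : Pred (Fin n) p} →
                IsPartialOrder _≡_ _≤_ → Decidable _≤_ → Decidable₁ P → ∀ {v} → P v →
                Σ[ m ∈ Fin n ] (m ≤ v × P m × (∀ w → P w → w ≤ m → w ≡ m))
minimal-below {n = n} {_≤_ = _≤_} {P = P} isPO _≤?_ P? = go (po-wellFounded isPO _)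
  where
  open IsPartialOrder isPO using () renaming (refl to ≤-refl; trans to ≤-trans)
  go : ∀ {v} → Acc (Strict._<_ _≡_ _≤_) v → P v →
       Σ[ m ∈ Fin n ] (m ≤ v × P m × (∀ w → P w → w ≤ m → w ≡ m))
  go {v} (acc below) Pv with any? (λ w → P? w ×-dec (w ≤? v) ×-dec ¬? (w ≟ v))
  ... | yes (w , Pw , w≤v , w≢v) =
    let (m , m≤w , Pm , m-min) = go (below (w≤v , w≢v)) Pw in m , ≤-trans m≤w w≤v , Pm , m-min
  ... | no ∄w =
    v , ≤-refl , Pv , λ w Pw w≤v → decidable-stable (w ≟ v) (λ w≢v → ∄w (w , Pw , w≤v , w≢v))

maximal-above : ∀ {p} {_≤_ : Rel (Fin n) ℓ} {P : Pred (Fin n) p} →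
                IsPartialOrder _≡_ _≤_ → Decidable _≤_ → Decidable₁ P → ∀ {v} → P v →
                Σ[ m ∈ Fin n ] (v ≤ m × P m × (∀ w → P w → m ≤ w → w ≡ m))
maximal-above isPO _≤?_ = minimal-below (Flip.isPartialOrder isPO) (flip _≤?_)

module _ {A : Set a} (_⊑_ : Rel A ℓ)
         (⊑-refl : ∀ {x} → x ⊑ x) (⊑-trans : ∀ {x y z} → x ⊑ y → y ⊑ z → x ⊑ z)
         (⊑-stable : ∀ {x y} → ¬ ¬ x ⊑ y → x ⊑ y)
         (size : A → ℕ) (bound : ℕ) (size-≤ : ∀ x → size x ≤ bound)
         (size-mono-< : ∀ {x y} → x ⊑ y → ¬ y ⊑ x → size x < size y) where

  Maximal : ∀ {p} → Pred A p → A → Set _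
  Maximal P x = P x × (∀ y → P y → x ⊑ y → y ⊑ x)

  ¬¬maximal-above : ∀ {p} {P : Pred A p} {x} → P x → ¬ ¬ (Σ[ y ∈ A ] (Maximal P y × x ⊑ y))
  ¬¬maximal-above {P = P} = go (<-wellFounded _)
    where
    go : ∀ {x} → Acc _<_ (bound ∸ size x) → P x → ¬ ¬ (Σ[ y ∈ A ] (Maximal P y × x ⊑ y))
    go {x} (acc smaller) Px ∄max = ¬¬-excluded-middle {A = Σ[ y ∈ A ] (P y × x ⊑ y × ¬ y ⊑ x)} λ where
      (yes (y , Py , x⊑y , y⋢x)) →
        go (smaller (∸-monoʳ-< (size-mono-< x⊑y y⋢x) (size-≤ y))) Py
           (λ (z , z-max , y⊑z) → ∄max (z , z-max , ⊑-trans x⊑y y⊑z))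
      (no ∄larger) →
        ∄max (x , (Px , λ y Py x⊑y → ⊑-stable (λ y⋢x → ∄larger (y , Py , x⊑y , y⋢x))) , ⊑-refl)

-- Reachability in a DAG

last-step : ∀ {a r} {A : Set a} {R : Rel A r} {x y} → Star R x y → x ≡ y ⊎ Σ[ z ∈ A ] (Star R x z × R z y)
last-step ε = inj₁ refl
last-step (r ◅ rs) with last-step rs
... | inj₁ refl           = inj₂ (_ , ε , r)
... | inj₂ (z , rs′ , r′) = inj₂ (z , r ◅ rs′ , r′)

module Reachability {n} (E : Graph n) (acyclic : IsDAG E) where

  infix 4 _≼_ _≺_

  _≼_ : Rel (Fin n) 0ℓ
  _≼_ = _⪯_ E

  _≺_ : Rel (Fin n) 0ℓ
  _≺_ = Strict._<_ _≡_ _≼_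

  ≼-trans : ∀ {a b c} → a ≼ b → b ≼ c → a ≼ c
  ≼-trans a≼b b≼c = b≼c ◅◅ a≼b

  edge⇒≼ : ∀ {a b} → Edge E a b → b ≼ a
  edge⇒≼ e = e ◅ ε

  ≼-antisym : ∀ {a b} → a ≼ b → b ≼ a → a ≡ b
  ≼-antisym ε       _   = refl
  ≼-antisym (e ◅ p) b≼a = ⊥-elim (acyclic _ _ e (p ◅◅ b≼a))

  no-loop : ∀ {a} → ¬ Edge E a a
  no-loop e = acyclic _ _ e ε

  edge⇒≺ : ∀ {a b} → Edge E a b → b ≺ a
  edge⇒≺ e = edge⇒≼ e , λ { refl → no-loop e }

  ≼-isPartialOrder : IsPartialOrder _≡_ _≼_
  ≼-isPartialOrder = record
    { isPreorder = record { isEquivalence = isEquivalence ; reflexive = λ { refl → ε } ; trans = ≼-trans }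
    ; antisym    = ≼-antisym
    }

  -- Recursion along edges, well-founded because E is acyclic.
  _≼?_ : Decidable _≼_
  u ≼? v = go (po-wellFounded ≼-isPartialOrder v)
    where
    first-step : ∀ {v} → u ≢ v → u ≼ v → Σ[ w ∈ Fin n ] (Edge E v w × u ≼ w)
    first-step u≢v ε       = ⊥-elim (u≢v refl)
    first-step u≢v (e ◅ p) = _ , e , p

    go : ∀ {v} → Acc _≺_ v → Dec (u ≼ v)
    go {v} (acc below) with u ≟ v
    ... | yes refl = yes ε
    ... | no u≢v   = map′ (λ (_ , e , u≼w) → e ◅ u≼w) (first-step u≢v) (any? through)
      where
      through : ∀ w → Dec (Edge E v w × u ≼ w)
      through w with E v w Bool.≟ true
      ... | yes e = map′ (e ,_) proj₂ (go (below (edge⇒≺ e)))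
      ... | no ¬e = no (¬e ∘ proj₁)

  minimal-below-≼ : ∀ {p} {P : Pred (Fin n) p} → Decidable₁ P → ∀ {v} → P v →
                    Σ[ m ∈ Fin n ] (m ≼ v × P m × (∀ w → P w → w ≼ m → w ≡ m))
  minimal-below-≼ = minimal-below ≼-isPartialOrder _≼?_

  sink-below : Fin n → Σ[ x ∈ Fin n ] (∀ c → ¬ Edge E x c)
  sink-below v =
    let (x , _ , _ , x-min) = minimal-below-≼ (λ _ → yes tt) {v} tt
    in x , λ c e → no-loop (subst (Edge E x) (x-min c tt (edge⇒≼ e)) e)

  least⇒hasUniqueMin : ∀ {P : Fin n → Set} {l} → P l → (∀ y → P y → l ≼ y) → HasUniqueMin E P
  least⇒hasUniqueMin {l = l} Pl least =
    l , (Pl , λ y Py y≼l → ≼-antisym y≼l (least y Py)) , λ m (Pm , m-min) → sym (m-min l Pl (least m Pm))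

  network⇒≼-root : (net : IsNetwork E) → ∀ v → v ≼ proj₁ (proj₂ net)
  network⇒≼-root (_ , r , _ , maximal-is-r) v =
    let (m , v≼m , _ , m-max) = maximal-above ≼-isPartialOrder _≼?_ (λ _ → yes tt) {v} tt
    in subst (v ≼_) (maximal-is-r m (λ w m≼w → m-max w tt m≼w)) v≼m

-- Joins, the global lca-property and holju graphs

module _ {n} (E : Graph n) where
  private
    infix 4 _≼_
    _≼_ = _⪯_ E

  IsJoin : Fin n → Fin n → Fin n → Set
  IsJoin a b l = a ≼ l × b ≼ l × (∀ w → a ≼ w → b ≼ w → l ≼ w)

  HasJoins : Set
  HasJoins = ∀ a b → Σ[ l ∈ Fin n ] IsJoin a b l

record JoinNetwork {n} (E : Graph n) : Set where
  field
    acyclic : IsDAG E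
    root    : Fin n
    ≼-root  : ∀ v → _⪯_ E v root
    join    : HasJoins E

module Suprema {n} (E : Graph n) (acyclic : IsDAG E) (join : HasJoins E) where
  open Reachability E acyclic

  BoundsFrom : (A : Fin n → Bool) → Fin n → ∀ {m} → (Fin m → Fin n) → Fin n → Set
  BoundsFrom A a₀ f w = a₀ ≼ w × (∀ i → A (f i) ≡ true → f i ≼ w)

  supremum : (A : Fin n → Bool) (a₀ : Fin n) → ∀ {m} (f : Fin m → Fin n) →
             Σ[ l ∈ Fin n ] (BoundsFrom A a₀ f l × (∀ w → BoundsFrom A a₀ f w → l ≼ w))
  supremum A a₀ {zero} f = a₀ , (ε , λ ()) , λ w (a₀≼w , _) → a₀≼w
  supremum A a₀ {suc m} f with supremum A a₀ (f ∘ suc) | A (f zero) in A-f₀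
  ... | l , (a₀≼l , f≼l) , l-least | false =
    l , (a₀≼l , λ { zero A-f₀′ → ⊥-elim (true⇒¬false A-f₀′ A-f₀) ; (suc i) → f≼l i })
      , λ w (a₀≼w , f≼w) → l-least w (a₀≼w , f≼w ∘ suc)
  ... | l , (a₀≼l , f≼l) , l-least | true =
    let (j , l≼j , f₀≼j , j-least) = join l (f zero) in
    j , (≼-trans a₀≼l l≼j , λ { zero _ → f₀≼j ; (suc i) Afi → ≼-trans (f≼l i Afi) l≼j })
      , λ w (a₀≼w , f≼w) → j-least w (l-least w (a₀≼w , f≼w ∘ suc)) (f≼w zero A-f₀)

  globalLCA : GlobalLCA E
  globalLCA A (a₀ , A-a₀) =
    let (l , (_ , bounded) , l-least) = supremum A a₀ (λ i → i) in
    l , (bounded , λ w w-bounds w≼l → ≼-antisym w≼l (l-least w (w-bounds a₀ A-a₀ , w-bounds)))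
      , λ w (w-bounds , w-min) → sym (w-min l bounded (l-least w (w-bounds a₀ A-a₀ , w-bounds)))

-- π lists the sink x first; E⁻ is E without x, relabelled along φ = π ∘ suc, so that
-- extend E⁻ W is E relabelled along π.
module SinkDeletion {k} {E : Graph (suc (suc k))} (net : JoinNetwork E)
                    (π : Permutation′ (suc (suc k))) (x-sink : ∀ c → ¬ Edge E (π ⟨$⟩ʳ zero) c) where
  open JoinNetwork net
  open Reachability E acyclic

  x : Fin (suc (suc k))
  x = π ⟨$⟩ʳ zero

  φ : Fin (suc k) → Fin (suc (suc k))
  φ a = π ⟨$⟩ʳ suc a

  E⁻ : Graph (suc k)
  E⁻ a b = E (φ a) (φ b)

  W : Fin (suc k) → Bool
  W a = E (φ a) x

  infix 4 _≼⁻_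
  _≼⁻_ : Rel (Fin (suc k)) 0ℓ
  _≼⁻_ = _⪯_ E⁻

  φ-injective : ∀ {a b} → φ a ≡ φ b → a ≡ b
  φ-injective = suc-injective ∘ Injection.injective (↔⇒↣ π)

  φ≢x : ∀ {a} → φ a ≢ x
  φ≢x φa≡x with Injection.injective (↔⇒↣ π) φa≡x
  ... | ()

  φ-preimage : ∀ {u} → u ≢ x → Σ[ a ∈ Fin (suc k) ] φ a ≡ u
  φ-preimage {u} u≢x with π ⟨$⟩ˡ u in π⁻¹u
  ... | zero  = ⊥-elim (u≢x (trans (sym (inverseʳ π)) (cong (π ⟨$⟩ʳ_) π⁻¹u)))
  ... | suc a = a , trans (cong (π ⟨$⟩ʳ_) (sym π⁻¹u)) (inverseʳ π)

  ≼x⇒≡x : ∀ {w} → w ≼ x → w ≡ x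
  ≼x⇒≡x ε       = refl
  ≼x⇒≡x (e ◅ _) = ⊥-elim (x-sink _ e)

  above-φ-preimage : ∀ {a u} → φ a ≼ u → Σ[ b ∈ Fin (suc k) ] φ b ≡ u
  above-φ-preimage φa≼u = φ-preimage λ { refl → φ≢x (≼x⇒≡x φa≼u) }

  source-preimage : ∀ {u w} → Edge E u w → Σ[ b ∈ Fin (suc k) ] φ b ≡ u
  source-preimage e = φ-preimage λ { refl → x-sink _ e }

  up : ∀ {a b} → a ≼⁻ b → φ a ≼ φ b
  up = gmap φ (λ e → e)

  down : ∀ {a b} → φ a ≼ φ b → a ≼⁻ b
  down p = go p refl refl
    where
    go : ∀ {u w a b} → Star (Edge E) u w → φ b ≡ u → φ a ≡ w → Star (Edge E⁻) b a
    go ε φb≡u φa≡u = subst (Star (Edge E⁻) _) (φ-injective (trans φb≡u (sym φa≡u))) ε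
    go (e ◅ p) refl refl with above-φ-preimage p
    ... | _ , refl = e ◅ go p refl refl

  network⁻ : JoinNetwork E⁻
  network⁻ = record
    { acyclic = λ a b e p → acyclic _ _ e (up p)
    ; root    = root⁻
    ; ≼-root  = λ v → down (subst (φ v ≼_) (sym φroot⁻≡root) (≼-root (φ v)))
    ; join    = join⁻
    }
    where
    root⁻ : Fin (suc k)
    root⁻ = proj₁ (above-φ-preimage (≼-root (φ zero)))
    φroot⁻≡root : φ root⁻ ≡ root
    φroot⁻≡root = proj₂ (above-φ-preimage (≼-root (φ zero)))
    join⁻ : HasJoins E⁻
    join⁻ a b with join (φ a) (φ b)
    ... | l , φa≼l , φb≼l , l-least with above-φ-preimage φa≼l
    ... | l⁻ , refl =
      l⁻ , down φa≼l , down φb≼l , λ w a≼w b≼w → down (l-least (φ w) (up a≼w) (up b≼w))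

  W-nonempty : Σ[ a ∈ Fin (suc k) ] W a ≡ true
  W-nonempty with last-step (≼-root x)
  ... | inj₁ root≡x = ⊥-elim (φ≢x (≼x⇒≡x (subst (φ zero ≼_) root≡x (≼-root (φ zero)))))
  ... | inj₂ (_ , _ , e) with source-preimage e
  ... | a , refl = a , e

  -- The join l of x and v is least in 𝓛(W | v): it is the LCA of v and of the in-neighbour
  -- of x on a path from l down to x.
  holju-condition : ∀ v → HasUniqueMin E⁻ (InL E⁻ W v)
  holju-condition v with join x (φ v)
  ... | l , x≼l , φv≼l , l-least with above-φ-preimage φv≼l
  ... | l⁻ , refl with last-step x≼l
  ... | inj₁ l≡x = ⊥-elim (φ≢x l≡x)
  ... | inj₂ (_ , l→c , c→x) with source-preimage c→x
  ... | c , refl =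
    Reachability.least⇒hasUniqueMin E⁻ (JoinNetwork.acyclic network⁻) (c , c→x , (λ { _ (inj₁ refl) → down l→c ; _ (inj₂ refl) → down φv≼l }) , l-min)
      λ y (w , Ww , bounds , _) → above-l (bounds w (inj₁ refl)) (bounds v (inj₂ refl)) Ww
    where
    above-l : ∀ {w y} → w ≼⁻ y → v ≼⁻ y → W w ≡ true → l⁻ ≼⁻ y
    above-l w≼y v≼y Ww = down (l-least _ (≼-trans (edge⇒≼ Ww) (up w≼y)) (up v≼y))
    l-min : ∀ y → (∀ a → a ≡ c ⊎ a ≡ v → a ≼⁻ y) → y ≼⁻ l⁻ → y ≡ l⁻
    l-min y bounds y≼l =
      φ-injective (≼-antisym (up y≼l) (up (above-l (bounds c (inj₁ refl)) (bounds v (inj₂ refl)) c→x)))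

holju-add-sink : ∀ {k} {E : Graph (suc (suc k))} (net : JoinNetwork E) {x} (x-sink : ∀ c → ¬ Edge E x c) →
                 IsHolju (SinkDeletion.E⁻ net (transpose zero x) x-sink) → IsHolju E
holju-add-sink {k} {E} net {x} x-sink (π₁ , IH) = π , add IH W-nonempty holju-condition extends
  where
  π : Permutation′ (suc (suc k))
  π = lift₀ π₁ ∘ₚ transpose zero x
  open SinkDeletion net π x-sink
  extends : ∀ a b → E (π ⟨$⟩ʳ a) (π ⟨$⟩ʳ b) ≡ extend E⁻ W a b
  extends zero    b       = ¬-not (x-sink (π ⟨$⟩ʳ b))
  extends (suc a) zero    = refl
  extends (suc a) (suc b) = refl

holju : ∀ {n} {E : Graph n} → JoinNetwork E → IsHolju E
holju {zero} net = ⊥-elim (¬Fin0 (JoinNetwork.root net))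
holju {suc zero} {E} net = id , k1 λ { zero zero → ¬-not (Reachability.no-loop E (JoinNetwork.acyclic net)) }
holju {suc (suc k)} {E} net =
  holju-add-sink net x-sink (holju (SinkDeletion.network⁻ net (transpose zero x) x-sink))
  where
  open JoinNetwork net using (acyclic; root)
  x : Fin (suc (suc k))
  x = proj₁ (Reachability.sink-below E acyclic root)
  x-sink : ∀ c → ¬ Edge E x c
  x-sink = proj₂ (Reachability.sink-below E acyclic root)

-- Subgraphs, chains and cycles

module Subgraphs {n} (E : Graph n) where

  infixl 6 _∪_

  point : Fin n → Subgraph E
  point v = record { vs = _== v ; es = λ _ _ → false ; es⊆ = λ _ _ () }

  edge : ∀ {u w} → Edge E u w → Subgraph E
  edge {u} {w} e = record { vs = λ y → y == u ∨ y == w ; es = λ c d → c == u ∧ d == w ; es⊆ = es⊆′ }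
    where
    es⊆′ : ∀ c d → c == u ∧ d == w ≡ true →
           E c d ≡ true × (c == u ∨ c == w) ≡ true × (d == u ∨ d == w) ≡ true
    es⊆′ c d cd with ∧-elim {c == u} cd
    ... | c==u , d==w with ==⇒≡ {x = c} {u} c==u | ==⇒≡ {x = d} {w} d==w
    ... | refl | refl = e , ∨-introˡ (==-refl c) , ∨-introʳ {d == c} (==-refl d)

  edge-ends : ∀ {u w} (e : Edge E u w) y → vs (edge e) y ≡ true → y ≡ u ⊎ y ≡ w
  edge-ends e y y∈ = Sum.map ==⇒≡ ==⇒≡ (∨-elim {y == _} y∈)

  _∪_ : Subgraph E → Subgraph E → Subgraph E
  K ∪ L = record { vs = λ y → vs K y ∨ vs L y ; es = λ c d → es K c d ∨ es L c d ; es⊆ = es⊆′ }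
    where
    es⊆′ : ∀ c d → es K c d ∨ es L c d ≡ true →
           E c d ≡ true × (vs K c ∨ vs L c) ≡ true × (vs K d ∨ vs L d) ≡ true
    es⊆′ c d cd with ∨-elim {es K c d} cd
    ... | inj₁ cd∈K = let (e , c∈ , d∈) = es⊆ K c d cd∈K in e , ∨-introˡ c∈ , ∨-introˡ d∈
    ... | inj₂ cd∈L = let (e , c∈ , d∈) = es⊆ L c d cd∈L in e , ∨-introʳ {vs K c} c∈ , ∨-introʳ {vs K d} d∈

  path : ∀ {u v} → Star (Edge E) u v → Subgraph E
  path {u} ε   = point u
  path (e ◅ p) = edge e ∪ path p

  ⊑-refl : ∀ {K} → _⊑_ E K K
  ⊑-refl = (λ _ y∈ → y∈) , (λ _ _ cd∈ → cd∈)

  ⊑-trans : ∀ {K L M} → _⊑_ E K L → _⊑_ E L M → _⊑_ E K M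
  ⊑-trans (K⊆L , K⊆Lᵉ) (L⊆M , L⊆Mᵉ) = (λ y → L⊆M y ∘ K⊆L y) , (λ c d → L⊆Mᵉ c d ∘ K⊆Lᵉ c d)

  ⊑-∪ˡ : ∀ K L → _⊑_ E K (K ∪ L)
  ⊑-∪ˡ K L = (λ _ → ∨-introˡ) , (λ _ _ → ∨-introˡ)

  ⊑-∪ʳ : ∀ K L → _⊑_ E L (K ∪ L)
  ⊑-∪ʳ K L = (λ y → ∨-introʳ {vs K y}) , (λ c d → ∨-introʳ {es K c d})

  ∪-comm-⊑ : ∀ K L → _⊑_ E (K ∪ L) (L ∪ K)
  ∪-comm-⊑ K L = (λ y → [ ∨-introʳ {vs L y} , ∨-introˡ ]′ ∘ ∨-elim {vs K y})
               , (λ c d → [ ∨-introʳ {es L c d} , ∨-introˡ ]′ ∘ ∨-elim {es K c d})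

  Walk : Subgraph E → Rel (Fin n) _
  Walk K = Star (UAdj E K)

  WalkAvoiding : Subgraph E → Fin n → Rel (Fin n) _
  WalkAvoiding K z = Star (UAdjWithout E K z)

  walk-reverse : ∀ K {x y} → Walk K x y → Walk K y x
  walk-reverse K = reverse Sum.swap

  walkAvoiding-reverse : ∀ K {z x y} → WalkAvoiding K z x y → WalkAvoiding K z y x
  walkAvoiding-reverse K = reverse λ (xy , x≢z , y≢z) → Sum.swap xy , y≢z , x≢z

  walk-mono : ∀ K L → _⊑_ E K L → ∀ {x y} → Walk K x y → Walk L x y
  walk-mono _ _ (_ , K⊆Lᵉ) = gmap (λ y → y) (Sum.map (K⊆Lᵉ _ _) (K⊆Lᵉ _ _))

  walkAvoiding-mono : ∀ K L → _⊑_ E K L → ∀ {z x y} → WalkAvoiding K z x y → WalkAvoiding L z x y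
  walkAvoiding-mono _ _ (_ , K⊆Lᵉ) =
    gmap (λ y → y) λ (xy , x≢z , y≢z) → Sum.map (K⊆Lᵉ _ _) (K⊆Lᵉ _ _) xy , x≢z , y≢z

  walkAvoiding-∪ˡ : ∀ K L {z x y} → WalkAvoiding K z x y → WalkAvoiding (K ∪ L) z x y
  walkAvoiding-∪ˡ K L = walkAvoiding-mono K (K ∪ L) (⊑-∪ˡ K L)

  walkAvoiding-∪ʳ : ∀ K L {z x y} → WalkAvoiding L z x y → WalkAvoiding (K ∪ L) z x y
  walkAvoiding-∪ʳ K L = walkAvoiding-mono L (K ∪ L) (⊑-∪ʳ K L)

  adjacent-∈ : ∀ K {x y} → UAdj E K x y → vs K x ≡ true × vs K y ≡ true
  adjacent-∈ K {x} {y} (inj₁ xy) = let (_ , x∈ , y∈) = es⊆ K x y xy in x∈ , y∈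
  adjacent-∈ K {x} {y} (inj₂ yx) = let (_ , y∈ , x∈) = es⊆ K y x yx in x∈ , y∈

  walk-avoids-absent : ∀ K {z} → vs K z ≡ false → ∀ {x y} → Walk K x y → WalkAvoiding K z x y
  walk-avoids-absent K z∉K = gmap (λ y → y) λ xy →
    let (x∈ , y∈) = adjacent-∈ K xy
    in xy , (λ { refl → true⇒¬false x∈ z∉K }) , (λ { refl → true⇒¬false y∈ z∉K })

  walkAvoiding-end : ∀ K {z x y} → WalkAvoiding K z x y → x ≢ z → y ≢ z
  walkAvoiding-end K ε                   x≢z = x≢z
  walkAvoiding-end K ((_ , _ , x′≢z) ◅ w) _  = walkAvoiding-end K w x′≢z

  connected-via : ∀ K c → (∀ y → vs K y ≡ true → Walk K y c) → Connected E K
  connected-via K c to-c x y x∈ y∈ = to-c x x∈ ◅◅ walk-reverse K (to-c y y∈)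

  record Chain (K : Subgraph E) (a b : Fin n) : Set where
    field
      a∈          : vs K a ≡ true
      b∈          : vs K b ≡ true
      connected   : Connected E K
      reaches-end : ∀ z y → vs K y ≡ true → y ≢ z → WalkAvoiding K z y a ⊎ WalkAvoiding K z y b
  open Chain

  chain-sym : ∀ {K a b} → Chain K a b → Chain K b a
  chain-sym s = record
    { a∈ = b∈ s ; b∈ = a∈ s ; connected = connected s
    ; reaches-end = λ z y y∈ y≢z → Sum.swap (reaches-end s z y y∈ y≢z) }

  point-chain : ∀ v → Chain (point v) v v
  point-chain v = record
    { a∈ = ==-refl v ; b∈ = ==-refl v
    ; connected = connected-via (point v) v λ y y==v → subst (λ t → Walk (point v) t v) (sym (==⇒≡ y==v)) ε
    ; reaches-end = λ z y y==v _ → inj₁ (subst (λ t → WalkAvoiding (point v) z t v) (sym (==⇒≡ y==v)) ε) }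

  edge-chain : ∀ {u w} (e : Edge E u w) → Chain (edge e) u w
  edge-chain {u} {w} e = record
    { a∈ = ∨-introˡ (==-refl u) ; b∈ = ∨-introʳ {w == u} (==-refl w)
    ; connected = connected-via (edge e) u to-u
    ; reaches-end = λ z y y∈ _ → Sum.map (λ { refl → ε }) (λ { refl → ε }) (edge-ends e y y∈) }
    where
    to-u : ∀ y → vs (edge e) y ≡ true → Walk (edge e) y u
    to-u y y∈ with edge-ends e y y∈
    ... | inj₁ refl = ε
    ... | inj₂ refl = inj₂ (∧-intro (==-refl u) (==-refl w)) ◅ ε

  private
    join-from-left : ∀ {K L a b c} → Chain K a c → Chain L c b →
                     (∀ y → vs K y ≡ true → vs L y ≡ true → y ≡ c) →
                     ∀ z y → vs K y ≡ true → y ≢ z →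
                     WalkAvoiding (K ∪ L) z y a ⊎ WalkAvoiding (K ∪ L) z y b
    join-from-left {K} {L} {a} {b} {c} s t K∩L⊆c z y y∈K y≢z with reaches-end s z y y∈K y≢z
    ... | inj₁ y→a = inj₁ (walkAvoiding-∪ˡ K L y→a)
    ... | inj₂ y→c with vs L z in z∈L | vs K z in z∈K
    ... | false | _     = inj₂ (walkAvoiding-∪ˡ K L y→c ◅◅
                                walkAvoiding-∪ʳ K L (walk-avoids-absent L z∈L (connected t c b (a∈ t) (b∈ t))))
    ... | true  | true  = ⊥-elim (walkAvoiding-end K y→c y≢z (sym (K∩L⊆c z z∈K z∈L)))
    ... | true  | false = inj₁ (walkAvoiding-∪ˡ K L (walk-avoids-absent K z∈K (connected s y a y∈K (a∈ s))))

  chain-join : ∀ {K L a b c} → Chain K a c → Chain L c b →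
               (∀ y → vs K y ≡ true → vs L y ≡ true → y ≡ c) → Chain (K ∪ L) a b
  chain-join {K} {L} {a} {b} {c} s t K∩L⊆c = record
    { a∈ = ∨-introˡ (a∈ s) ; b∈ = ∨-introʳ {vs K b} (b∈ t)
    ; connected = connected-via (K ∪ L) c to-c
    ; reaches-end = reaches }
    where
    to-c : ∀ y → vs (K ∪ L) y ≡ true → Walk (K ∪ L) y c
    to-c y y∈ with ∨-elim {vs K y} y∈
    ... | inj₁ y∈K = walk-mono K (K ∪ L) (⊑-∪ˡ K L) (connected s y c y∈K (b∈ s))
    ... | inj₂ y∈L = walk-mono L (K ∪ L) (⊑-∪ʳ K L) (connected t y c y∈L (a∈ t))
    reaches : ∀ z y → vs (K ∪ L) y ≡ true → y ≢ z →
              WalkAvoiding (K ∪ L) z y a ⊎ WalkAvoiding (K ∪ L) z y b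
    reaches z y y∈ y≢z with ∨-elim {vs K y} y∈
    ... | inj₁ y∈K = join-from-left s t K∩L⊆c z y y∈K y≢z
    ... | inj₂ y∈L = Sum.swap (Sum.map comm comm
                       (join-from-left (chain-sym t) (chain-sym s) (λ y y∈L y∈K → K∩L⊆c y y∈K y∈L) z y y∈L y≢z))
      where
      comm : ∀ {z x y} → WalkAvoiding (L ∪ K) z x y → WalkAvoiding (K ∪ L) z x y
      comm = walkAvoiding-mono (L ∪ K) (K ∪ L) (∪-comm-⊑ L K)

  cycle-biconnected : ∀ {K a b} → Chain K a b → (e : Edge E b a) → Biconnected E (K ∪ edge e)
  cycle-biconnected {K} {a} {b} s e =
    (λ x y x∈ y∈ → walk-mono K C K⊑C (connected s x y (∈K x∈) (∈K y∈))) ,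
    (λ z _ x y x∈ y∈ x≢z y≢z → to-hub z x x∈ x≢z ◅◅ walkAvoiding-reverse C (to-hub z y y∈ y≢z))
    where
    C : Subgraph E
    C = K ∪ edge e
    K⊑C : _⊑_ E K C
    K⊑C = ⊑-∪ˡ K (edge e)
    ∈K : ∀ {y} → vs C y ≡ true → vs K y ≡ true
    ∈K {y} y∈ with ∨-elim {vs K y} y∈
    ... | inj₁ y∈K = y∈K
    ... | inj₂ y∈e with edge-ends e y y∈e
    ... | inj₁ refl = b∈ s
    ... | inj₂ refl = a∈ s
    closing : es C b a ≡ true
    closing = ∨-introʳ {es K b a} (∧-intro (==-refl b) (==-refl a))
    -- Without z every vertex reaches a (b if z = a): along the chain, then the closing edge.
    hub : Fin n → Fin n
    hub z = if does (a ≟ z) then b else a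
    to-hub : ∀ z y → vs C y ≡ true → y ≢ z → WalkAvoiding C z y (hub z)
    to-hub z y y∈ y≢z with a ≟ z | reaches-end s z y (∈K y∈) y≢z
    ... | yes refl | inj₁ y→a = ⊥-elim (walkAvoiding-end K y→a y≢z refl)
    ... | yes refl | inj₂ y→b = walkAvoiding-mono K C K⊑C y→b
    ... | no _     | inj₁ y→a = walkAvoiding-mono K C K⊑C y→a
    ... | no a≢z   | inj₂ y→b =
      walkAvoiding-mono K C K⊑C y→b ◅◅ (inj₁ closing , walkAvoiding-end K y→b y≢z , a≢z) ◅ ε

module Paths {n} (E : Graph n) (acyclic : IsDAG E) where
  open Reachability E acyclic
  open Subgraphs E

  path-end : ∀ {u v} (p : Star (Edge E) u v) → vs (path p) v ≡ true
  path-end {v = v} ε       = ==-refl v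
  path-end {v = v} (e ◅ p) = ∨-introʳ {vs (edge e) v} (path-end p)

  ∈path⇒between : ∀ {u v} (p : Star (Edge E) u v) y → vs (path p) y ≡ true → y ≼ u × v ≼ y
  ∈path⇒between ε       y y∈ rewrite ==⇒≡ {x = y} y∈ = ε , ε
  ∈path⇒between (e ◅ p) y y∈ with ∨-elim {vs (edge e) y} y∈
  ... | inj₂ y∈p = let (y≼w , v≼y) = ∈path⇒between p y y∈p in ≼-trans y≼w (edge⇒≼ e) , v≼y
  ... | inj₁ y∈e with edge-ends e y y∈e
  ... | inj₁ refl = ε , e ◅ p
  ... | inj₂ refl = edge⇒≼ e , p

  path-chain : ∀ {u v} (p : Star (Edge E) u v) → Chain (path p) u v
  path-chain ε       = point-chain _
  path-chain (_◅_ {j = w} e p) =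
    chain-join (edge-chain e) (path-chain p) λ y y∈e y∈p → meet y y∈e (proj₁ (∈path⇒between p y y∈p))
    where
    meet : ∀ y → vs (edge e) y ≡ true → y ≼ w → y ≡ w
    meet y y∈e y≼w with edge-ends e y y∈e
    ... | inj₁ refl = ⊥-elim (acyclic _ _ e y≼w)
    ... | inj₂ refl = refl

  last-edge : ∀ {u v} (p : Star (Edge E) u v) → u ≢ v → Σ[ q ∈ Fin n ] es (path p) q v ≡ true
  last-edge ε       u≢u = ⊥-elim (u≢u refl)
  last-edge (e ◅ p) _   = nonempty e p
    where
    nonempty : ∀ {u w v} (e : Edge E u w) (p : Star (Edge E) w v) →
               Σ[ q ∈ Fin n ] es (path (e ◅ p)) q v ≡ true
    nonempty {u} {w} e ε = u , ∨-introˡ (∧-intro (==-refl u) (==-refl w))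
    nonempty {v = v} e (e′ ◅ p) = let (q , qv∈) = nonempty e′ p in q , ∨-introʳ {es (edge e) q v} qv∈

  record Entry {p} (D : Pred (Fin n) p) (u w : Fin n) : Set p where
    field
      {last entry}   : Fin n
      prefix         : Star (Edge E) u last
      prefix-outside : ∀ y → vs (path prefix) y ≡ true → ¬ D y
      crossing       : Edge E last entry
      entry-inside   : D entry
      entry-above    : w ≼ entry

  first-entry : ∀ {p} {D : Pred (Fin n) p} → Decidable₁ D → ∀ {u w} → w ≼ u → ¬ D u → D w → Entry D u w
  first-entry D? ε ¬Du Dw = ⊥-elim (¬Du Dw)
  first-entry {D = D} D? {u} (_◅_ {j = u′} e rest) ¬Du Dw with D? u′
  ... | yes Du′ = record
    { prefix = ε ; prefix-outside = λ y y∈ → subst (λ t → ¬ D t) (sym (==⇒≡ y∈)) ¬Du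
    ; crossing = e ; entry-inside = Du′ ; entry-above = rest }
  ... | no ¬Du′ = record
    { prefix = e ◅ prefix ; prefix-outside = outside
    ; crossing = crossing ; entry-inside = entry-inside ; entry-above = entry-above }
    where
    open Entry (first-entry D? rest ¬Du′ Dw)
    outside : ∀ y → vs (path (e ◅ prefix)) y ≡ true → ¬ D y
    outside y y∈ with ∨-elim {vs (edge e) y} y∈
    ... | inj₂ y∈prefix = prefix-outside y y∈prefix
    ... | inj₁ y∈e with edge-ends e y y∈e
    ... | inj₁ refl = ¬Du
    ... | inj₂ refl = ¬Du′

-- Hybrids and minimal common ancestors

module _ {n} (E : Graph n) where

  IsHybridIn : Subgraph E → Fin n → Set
  IsHybridIn C v = Σ[ p ∈ Fin n ] Σ[ q ∈ Fin n ] (p ≢ q × es C p v ≡ true × es C q v ≡ true)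

  BiconnectedHybridsCoincide : Set
  BiconnectedHybridsCoincide = ∀ C → Biconnected E C → ∀ u v → IsHybridIn C u → IsHybridIn C v → u ≡ v

module CommonAncestors {n} {E : Graph n} (acyclic : IsDAG E) (hybrids-coincide : BiconnectedHybridsCoincide E) where
  open Reachability E acyclic
  open Subgraphs E
  open Paths E acyclic

  IsCommonAncestor : Fin n → Fin n → Fin n → Set
  IsCommonAncestor a b w = a ≼ w × b ≼ w

  IsMinimalCommonAncestor : Fin n → Fin n → Fin n → Set
  IsMinimalCommonAncestor a b m = IsCommonAncestor a b m × (∀ w → IsCommonAncestor a b w → w ≼ m → w ≡ m)

  -- The cycle is m₁ –P₁→ p₁ –e₁→ h₁ ←Q₁– m₂ –Q₂→ h₂ ←e₂– p₂ ←P₂– m₁, with P₁, P₂ outside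
  -- the down-set D of m₂ and Q₁, Q₂ inside it.
  module TwoMinimal {a b m₁ m₂} (m₁-min : IsMinimalCommonAncestor a b m₁)
                    (m₂-min : IsMinimalCommonAncestor a b m₂) (m₁≢m₂ : m₁ ≢ m₂) where

    D : Pred (Fin n) 0ℓ
    D w = w ≼ m₂

    a≼m₁ : a ≼ m₁
    a≼m₁ = proj₁ (proj₁ m₁-min)

    b≼m₁ : b ≼ m₁
    b≼m₁ = proj₂ (proj₁ m₁-min)

    a≼m₂ : a ≼ m₂
    a≼m₂ = proj₁ (proj₁ m₂-min)

    b≼m₂ : b ≼ m₂
    b≼m₂ = proj₂ (proj₁ m₂-min)

    below-m₁ : ∀ {y} → a ≼ y → b ≼ y → y ≼ m₁ → y ≡ m₁
    below-m₁ a≼y b≼y = proj₂ m₁-min _ (a≼y , b≼y)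

    below-m₂ : ∀ {y} → a ≼ y → b ≼ y → y ≼ m₂ → y ≡ m₂
    below-m₂ a≼y b≼y = proj₂ m₂-min _ (a≼y , b≼y)

    m₁∉D : ¬ D m₁
    m₁∉D m₁≼m₂ = m₁≢m₂ (below-m₂ a≼m₁ b≼m₁ m₁≼m₂)

    open Entry (first-entry (_≼? m₂) a≼m₁ m₁∉D a≼m₂)
      renaming (last to p₁; entry to h₁; prefix to P₁; prefix-outside to P₁∉D; crossing to e₁;
                entry-inside to Q₁; entry-above to a≼h₁)
    open Entry (first-entry (_≼? m₂) b≼m₁ m₁∉D b≼m₂)
      renaming (last to p₂; entry to h₂; prefix to P₂; prefix-outside to P₂∉D; crossing to e₂;
                entry-inside to Q₂; entry-above to b≼h₂)

    h₁≼m₁ : h₁ ≼ m₁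
    h₁≼m₁ = ≼-trans (edge⇒≼ e₁) P₁

    h₂≼m₁ : h₂ ≼ m₁
    h₂≼m₁ = ≼-trans (edge⇒≼ e₂) P₂

    h₁≢h₂ : h₁ ≢ h₂
    h₁≢h₂ h₁≡h₂ = m₁∉D (subst D (below-m₁ a≼h₁ (subst (b ≼_) (sym h₁≡h₂) b≼h₂) h₁≼m₁) Q₁)

    m₂≢h : ∀ {h} → h ≼ m₁ → m₂ ≢ h
    m₂≢h h≼m₁ refl = m₁≢m₂ (sym (below-m₁ a≼m₂ b≼m₂ h≼m₁))

    Qs P₂⁺ K C : Subgraph E
    Qs  = path Q₁ ∪ path Q₂
    P₂⁺ = path P₂ ∪ edge e₂
    K   = (Qs ∪ P₂⁺) ∪ path P₁
    C   = K ∪ edge e₁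

    Qs⊆D : ∀ y → vs Qs y ≡ true → D y
    Qs⊆D y y∈ with ∨-elim {vs (path Q₁) y} y∈
    ... | inj₁ y∈Q₁ = proj₁ (∈path⇒between Q₁ y y∈Q₁)
    ... | inj₂ y∈Q₂ = proj₁ (∈path⇒between Q₂ y y∈Q₂)

    Q₁∩Q₂⊆m₂ : ∀ y → vs (path Q₁) y ≡ true → vs (path Q₂) y ≡ true → y ≡ m₂
    Q₁∩Q₂⊆m₂ y y∈Q₁ y∈Q₂ =
      let (y≼m₂ , h₁≼y) = ∈path⇒between Q₁ y y∈Q₁
          (_    , h₂≼y) = ∈path⇒between Q₂ y y∈Q₂
      in below-m₂ (≼-trans a≼h₁ h₁≼y) (≼-trans b≼h₂ h₂≼y) y≼m₂

    P₁∩P₂⊆m₁ : ∀ y → vs (path P₁) y ≡ true → vs (path P₂) y ≡ true → y ≡ m₁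
    P₁∩P₂⊆m₁ y y∈P₁ y∈P₂ =
      let (y≼m₁ , p₁≼y) = ∈path⇒between P₁ y y∈P₁
          (_    , p₂≼y) = ∈path⇒between P₂ y y∈P₂
      in below-m₁ (≼-trans a≼h₁ (≼-trans (edge⇒≼ e₁) p₁≼y))
                  (≼-trans b≼h₂ (≼-trans (edge⇒≼ e₂) p₂≼y)) y≼m₁

    P₂⁺-vertices : ∀ y → vs P₂⁺ y ≡ true → vs (path P₂) y ≡ true ⊎ y ≡ h₂
    P₂⁺-vertices y y∈ with ∨-elim {vs (path P₂) y} y∈
    ... | inj₁ y∈P₂ = inj₁ y∈P₂
    ... | inj₂ y∈e₂ with edge-ends e₂ y y∈e₂
    ... | inj₁ refl = inj₁ (path-end P₂)
    ... | inj₂ refl = inj₂ refl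

    Qs-chain : Chain Qs h₁ h₂
    Qs-chain = chain-join (chain-sym (path-chain Q₁)) (path-chain Q₂) Q₁∩Q₂⊆m₂

    P₂⁺-chain : Chain P₂⁺ m₁ h₂
    P₂⁺-chain = chain-join (path-chain P₂) (edge-chain e₂) λ y y∈P₂ y∈e₂ →
      [ (λ y≡p₂ → y≡p₂) , (λ { refl → ⊥-elim (P₂∉D _ y∈P₂ Q₂) }) ]′ (edge-ends e₂ y y∈e₂)

    K-chain : Chain K h₁ p₁
    K-chain =
      chain-join (chain-join Qs-chain (chain-sym P₂⁺-chain) Qs∩P₂⁺⊆h₂) (path-chain P₁) Qs∪P₂⁺∩P₁⊆m₁
      where
      Qs∩P₂⁺⊆h₂ : ∀ y → vs Qs y ≡ true → vs P₂⁺ y ≡ true → y ≡ h₂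
      Qs∩P₂⁺⊆h₂ y y∈Qs y∈P₂⁺ with P₂⁺-vertices y y∈P₂⁺
      ... | inj₁ y∈P₂ = ⊥-elim (P₂∉D y y∈P₂ (Qs⊆D y y∈Qs))
      ... | inj₂ y≡h₂ = y≡h₂
      Qs∪P₂⁺∩P₁⊆m₁ : ∀ y → vs (Qs ∪ P₂⁺) y ≡ true → vs (path P₁) y ≡ true → y ≡ m₁
      Qs∪P₂⁺∩P₁⊆m₁ y y∈ y∈P₁ with ∨-elim {vs Qs y} y∈
      ... | inj₁ y∈Qs = ⊥-elim (P₁∉D y y∈P₁ (Qs⊆D y y∈Qs))
      ... | inj₂ y∈P₂⁺ with P₂⁺-vertices y y∈P₂⁺
      ... | inj₁ y∈P₂ = P₁∩P₂⊆m₁ y y∈P₁ y∈P₂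
      ... | inj₂ refl = ⊥-elim (P₁∉D _ y∈P₁ Q₂)

    last-into-Q : ∀ {h} (Q : h ≼ m₂) → h ≼ m₁ → Σ[ q ∈ Fin n ] (es (path Q) q h ≡ true × D q)
    last-into-Q {h} Q h≼m₁ =
      let (q , qh∈Q) = last-edge Q (m₂≢h h≼m₁)
      in q , qh∈Q , proj₁ (∈path⇒between Q q (proj₁ (proj₂ (es⊆ (path Q) q h qh∈Q))))

    h₁-hybrid : IsHybridIn E C h₁
    h₁-hybrid =
      let (q₁ , q₁h₁∈Q₁ , q₁∈D) = last-into-Q Q₁ h₁≼m₁
      in p₁ , q₁ , (λ p₁≡q₁ → P₁∉D p₁ (path-end P₁) (subst D (sym p₁≡q₁) q₁∈D))
       , ∨-introʳ {es K p₁ h₁} (∧-intro (==-refl p₁) (==-refl h₁))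
       , ∨-introˡ (∨-introˡ (∨-introˡ (∨-introˡ q₁h₁∈Q₁)))

    e₂∈P₂⁺ : es P₂⁺ p₂ h₂ ≡ true
    e₂∈P₂⁺ = ∨-introʳ {es (path P₂) p₂ h₂} (∧-intro (==-refl p₂) (==-refl h₂))

    h₂-hybrid : IsHybridIn E C h₂
    h₂-hybrid =
      let (q₂ , q₂h₂∈Q₂ , q₂∈D) = last-into-Q Q₂ h₂≼m₁
      in p₂ , q₂ , (λ p₂≡q₂ → P₂∉D p₂ (path-end P₂) (subst D (sym p₂≡q₂) q₂∈D))
       , ∨-introˡ (∨-introˡ (∨-introʳ {es Qs p₂ h₂} e₂∈P₂⁺))
       , ∨-introˡ (∨-introˡ (∨-introˡ (∨-introʳ {es (path Q₁) q₂ h₂} q₂h₂∈Q₂)))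

    absurd : ⊥
    absurd = h₁≢h₂ (hybrids-coincide C (cycle-biconnected K-chain e₁) h₁ h₂ h₁-hybrid h₂-hybrid)

  minimal-common-ancestors-coincide : ∀ {a b m₁ m₂} → IsMinimalCommonAncestor a b m₁ →
                                      IsMinimalCommonAncestor a b m₂ → m₁ ≡ m₂
  minimal-common-ancestors-coincide {m₁ = m₁} {m₂} m₁-min m₂-min =
    decidable-stable (m₁ ≟ m₂) (TwoMinimal.absurd m₁-min m₂-min)

  joins : ∀ r → (∀ v → v ≼ r) → HasJoins E
  joins r ≼r a b =
    let (m , _ , m-ca , m-min) = minimal-below-≼ common? (≼r a , ≼r b)
    in m , proj₁ m-ca , proj₂ m-ca , λ w a≼w b≼w →
         let (m′ , m′≼w , m′-ca , m′-min) = minimal-below-≼ common? (a≼w , b≼w)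
         in subst (_≼ w) (minimal-common-ancestors-coincide (m′-ca , m′-min) (m-ca , m-min)) m′≼w
    where
    common? : Decidable₁ (IsCommonAncestor a b)
    common? w = (a ≼? w) ×-dec (b ≼? w)

-- Level-1 networks and galled trees

module MaximalBiconnected {n} (E : Graph n) where
  open Subgraphs E

  size : Subgraph E → ℕ
  size H = count (vs H) + sum (tabulate λ c → count (es H c))

  size-≤ : ∀ H → size H ≤ n + n * n
  size-≤ H = +-mono-≤ (count-≤ (vs H)) (sum-tabulate-≤ n _ (count-≤ ∘ es H))

  ⊑-stable : ∀ {H H′} → ¬ ¬ _⊑_ E H H′ → _⊑_ E H H′
  ⊑-stable ¬¬H⊑H′ =
    (λ c c∈ → ¬-not λ c∉ → ¬¬H⊑H′ λ H⊑H′ → true⇒¬false (proj₁ H⊑H′ c c∈) c∉) ,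
    (λ c d cd∈ → ¬-not λ cd∉ → ¬¬H⊑H′ λ H⊑H′ → true⇒¬false (proj₂ H⊑H′ c d cd∈) cd∉)

  size-mono-< : ∀ {H H′} → _⊑_ E H H′ → ¬ _⊑_ E H′ H → size H < size H′
  size-mono-< {H} {H′} (vs⊆ , es⊆′) H′⋢H = decidable-stable (size H <? size H′) λ ¬< → H′⋢H
    ( (λ c c∈H′ → ¬-not λ c∉H → ¬< (+-mono-<-≤ (count-mono-< _ _ vs⊆ c c∉H c∈H′) es-≤))
    , (λ c d cd∈H′ → ¬-not λ cd∉H → ¬< (+-mono-≤-< (count-mono-≤ _ _ vs⊆)
        (sum-tabulate-mono-< _ _ (λ c → count-mono-≤ _ _ (es⊆′ c)) c (count-mono-< _ _ (es⊆′ c) d cd∉H cd∈H′)))) )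
    where
    es-≤ : sum (tabulate λ c → count (es H c)) ≤ sum (tabulate λ c → count (es H′ c))
    es-≤ = sum-tabulate-mono-≤ _ _ (λ c → count-mono-≤ _ _ (es⊆′ c))

  ¬¬maxBiconnected-above : ∀ {H} → Biconnected E H →
                           ¬ ¬ (Σ[ H′ ∈ Subgraph E ] (MaxBiconnected E H′ × _⊑_ E H H′))
  ¬¬maxBiconnected-above {H} =
    ¬¬maximal-above (_⊑_ E) (λ {K} → ⊑-refl {K}) (λ {K} {L} {M} → ⊑-trans {K} {L} {M})
                    (λ {K} {L} → ⊑-stable {K} {L}) size (n + n * n) size-≤ (λ {K} {L} → size-mono-< {K} {L})
                    {P = Biconnected E} {H}

  hybrid-mono : ∀ {C H v} → _⊑_ E C H → IsHybridIn E C v → IsHybridIn E H v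
  hybrid-mono (_ , C⊆H) (p , q , p≢q , pv∈ , qv∈) = p , q , p≢q , C⊆H _ _ pv∈ , C⊆H _ _ qv∈

  -- Maximal biconnected supergraphs are only obtained under ¬¬ (biconnectivity is not
  -- decided), which suffices because equality on Fin is stable.
  hybridsCoincide-from-blocks :
    (∀ H → MaxBiconnected E H → ∀ u v → IsHybridIn E H u → IsHybridIn E H v → u ≡ v) →
    BiconnectedHybridsCoincide E
  hybridsCoincide-from-blocks in-blocks C C-bic u v u-hyb v-hyb =
    decidable-stable (u ≟ v) λ u≢v →
      ¬¬maxBiconnected-above {C} C-bic λ (H , H-max , C⊑H) →
        u≢v (in-blocks H H-max u v (hybrid-mono {C} {H} C⊑H u-hyb) (hybrid-mono {C} {H} C⊑H v-hyb))

indeg≡count : ∀ {n} (E : Graph n) v → indeg E v ≡ count (λ u → E u v)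
indeg≡count E v = cong sum (map-tabulate (λ u → u) (λ u → indicator (E u v)))

level1⇒hybridsCoincide : ∀ {n} {E : Graph n} → IsLevel1 E → BiconnectedHybridsCoincide E
level1⇒hybridsCoincide {E = E} level1 =
  MaximalBiconnected.hybridsCoincide-from-blocks E λ H H-max u v u-hyb v-hyb →
    level1 H H-max u v (target-∈ H u-hyb) (target-∈ H v-hyb) (indeg>1 H u-hyb) (indeg>1 H v-hyb)
  where
  target-∈ : ∀ H {v} → IsHybridIn E H v → vs H v ≡ true
  target-∈ H (p , _ , _ , pv∈ , _) = proj₂ (proj₂ (es⊆ H p _ pv∈))
  indeg>1 : ∀ H {v} → IsHybridIn E H v → 1 < indeg E v
  indeg>1 H {v} (p , q , p≢q , pv∈ , qv∈) =
    subst (1 <_) (sym (indeg≡count E v))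
          (count-≥2 _ p q (proj₁ (es⊆ H p v pv∈)) (proj₁ (es⊆ H q v qv∈)) p≢q)

module DirectedPaths {n} {E : Graph n} (acyclic : IsDAG E) where

  EdgeP-source-reachable : ∀ {u v c d} (p : DPath E u v) → EdgeP E p c d → Star (Edge E) u c
  EdgeP-source-reachable (step e p) (inj₁ (refl , refl)) = ε
  EdgeP-source-reachable (step e p) (inj₂ cd∈p)          = e ◅ EdgeP-source-reachable p cd∈p

  EdgeP⇒Edge : ∀ {u v c d} (p : DPath E u v) → EdgeP E p c d → Edge E c d
  EdgeP⇒Edge (step e p) (inj₁ (refl , refl)) = e
  EdgeP⇒Edge (step e p) (inj₂ cd∈p)          = EdgeP⇒Edge p cd∈p

  start-∈P : ∀ {u v} (p : DPath E u v) → _∈P_ E u p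
  start-∈P (stop _)   = refl
  start-∈P (step e p) = inj₁ refl

  EdgeP-target-∈P : ∀ {u v c d} (p : DPath E u v) → EdgeP E p c d → _∈P_ E d p
  EdgeP-target-∈P (step e p) (inj₁ (refl , refl)) = inj₂ (start-∈P p)
  EdgeP-target-∈P (step e p) (inj₂ cd∈p)          = inj₂ (EdgeP-target-∈P p cd∈p)

  ¬EdgeP-into-start : ∀ {u v c} (p : DPath E u v) → ¬ EdgeP E p c u
  ¬EdgeP-into-start p cu∈p = acyclic _ _ (EdgeP⇒Edge p cu∈p) (EdgeP-source-reachable p cu∈p)

  EdgeP-source-unique : ∀ {u v c c′ d} (p : DPath E u v) → EdgeP E p c d → EdgeP E p c′ d → c ≡ c′
  EdgeP-source-unique (step e p) (inj₁ (refl , refl)) (inj₁ (refl , refl)) = refl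
  EdgeP-source-unique (step e p) (inj₁ (refl , refl)) (inj₂ c′d∈p)         = ⊥-elim (¬EdgeP-into-start p c′d∈p)
  EdgeP-source-unique (step e p) (inj₂ cd∈p)          (inj₁ (refl , refl)) = ⊥-elim (¬EdgeP-into-start p cd∈p)
  EdgeP-source-unique (step e p) (inj₂ cd∈p)          (inj₂ c′d∈p)         = EdgeP-source-unique p cd∈p c′d∈p

  shared-target-is-end : ∀ {u v c c′ h} (p q : DPath E u v) →
                         (∀ y → _∈P_ E y p → _∈P_ E y q → y ≡ u ⊎ y ≡ v) →
                         EdgeP E p c h → EdgeP E q c′ h → h ≡ v
  shared-target-is-end p q shared ch∈p c′h∈q
    with shared _ (EdgeP-target-∈P p ch∈p) (EdgeP-target-∈P q c′h∈q)
  ... | inj₁ refl = ⊥-elim (¬EdgeP-into-start p ch∈p)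
  ... | inj₂ h≡v  = h≡v

  twoPaths-hybrid-is-end : ∀ {H} ((u , v , _) : TwoPaths E H) → ∀ {h} → IsHybridIn E H h → h ≡ v
  twoPaths-hybrid-is-end (u , v , p , q , _ , _ , _ , edges , shared) {h} (c , c′ , c≢c′ , ch∈ , c′h∈)
    with Equivalence.to (edges c h) ch∈ | Equivalence.to (edges c′ h) c′h∈
  ... | inj₁ ch∈p | inj₁ c′h∈p = ⊥-elim (c≢c′ (EdgeP-source-unique p ch∈p c′h∈p))
  ... | inj₂ ch∈q | inj₂ c′h∈q = ⊥-elim (c≢c′ (EdgeP-source-unique q ch∈q c′h∈q))
  ... | inj₁ ch∈p | inj₂ c′h∈q = shared-target-is-end p q shared ch∈p c′h∈q
  ... | inj₂ ch∈q | inj₁ c′h∈p = shared-target-is-end p q shared c′h∈p ch∈q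

  galled-block-hybrids-coincide : ∀ {H} → SingleVertex E H ⊎ SingleEdge E H ⊎ TwoPaths E H →
                                  ∀ {u v} → IsHybridIn E H u → IsHybridIn E H v → u ≡ v
  galled-block-hybrids-coincide (inj₁ (_ , _ , no-edges)) (p , _ , _ , pu∈ , _) _ =
    ⊥-elim (true⇒¬false pu∈ (no-edges p _))
  galled-block-hybrids-coincide (inj₂ (inj₁ (_ , _ , _ , edges))) {u} (p , q , p≢q , pu∈ , qu∈) _ =
    ⊥-elim (p≢q (trans (proj₁ (Equivalence.to (edges p u) pu∈)) (sym (proj₁ (Equivalence.to (edges q u) qu∈)))))
  galled-block-hybrids-coincide {H} (inj₂ (inj₂ two)) u-hyb v-hyb =
    trans (twoPaths-hybrid-is-end {H} two u-hyb) (sym (twoPaths-hybrid-is-end {H} two v-hyb))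

galledTree⇒hybridsCoincide : ∀ {n} {E : Graph n} → IsGalledTree E → BiconnectedHybridsCoincide E
galledTree⇒hybridsCoincide {E = E} (net , blocks) =
  MaximalBiconnected.hybridsCoincide-from-blocks E λ H H-max u v →
    DirectedPaths.galled-block-hybrids-coincide (proj₁ net) {H} (blocks H H-max)

globalLCA-and-holju : ∀ {n} {N : Graph n} → IsNetwork N → BiconnectedHybridsCoincide N →
                      GlobalLCA N × IsHolju N
globalLCA-and-holju {n} {N} net hybrids-coincide = Suprema.globalLCA N acyclic join , holju network
  where
  acyclic : IsDAG N
  acyclic = proj₁ net
  root : Fin n
  root = proj₁ (proj₂ net)
  ≼-root : ∀ v → _⪯_ N v root
  ≼-root = Reachability.network⇒≼-root N acyclic net
  join : HasJoins N
  join = CommonAncestors.joins acyclic hybrids-coincide root ≼-root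
  network : JoinNetwork N
  network = record { acyclic = acyclic ; root = root ; ≼-root = ≼-root ; join = join }

corollary6p8 : (n : ℕ) (N : Graph n) →
    (IsNetwork N → IsLevel1 N → GlobalLCA N × IsHolju N)
    × (IsGalledTree N → GlobalLCA N × IsHolju N)
corollary6p8 n N = (λ net level1 → globalLCA-and-holju net (level1⇒hybridsCoincide level1))
                 , (λ galled → globalLCA-and-holju (proj₁ galled) (galledTree⇒hybridsCoincide galled))
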